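{- There is a computable function $\mathrm{red}$ such that for every tree $T=(T,\le,r)$ and every weak MSO sentence $\varphi$ of the signature $(\le,r,U)$, where $U\subseteq T$ is the union of all infinite branches of $T$, we have $(T,\le,r,U)\models^{\mathrm w}\varphi$ iff $(T^\infty,\mathrm{clone})\models^{\mathrm w}\mathrm{red}(\varphi)$, where $(T^\infty,\mathrm{clone})$ is the infinitary Muchnik iteration of $(T,\le,r)$ (without the predicate $U$).
   Context: A tree is a structure $(T,\le,r)$ where $\le$ is a partial order such that for every $v$ the set of $\le$-predecessors of $v$ is a finite linear order and $r\le v$ for all $v$. An infinite branch is an infinite maximal chain. $\models^{\mathrm w}$: MSO satisfaction with set quantifiers ranging over finite sets. For a structure with universe $A$ and relations $R$ (the root treated as the unary relation $\{r\}$), the infinitary Shelah–Stupp iteration is $(A^\infty,\preceq,(\hat R)_R,\varepsilon)$, where $A^\infty$ is the set of finite and infinite words over $A$, $\preceq$ the prefix order, $\varepsilon$ a constant, and $\hat R=\{(ua_1,\dots,ua_n)\mid u\in A^*,(a_1,\dots,a_n)\in R\}$; the infinitary Muchnik iteration adds the unary predicate $\mathrm{clone}=\{uaa\mid u\in A^*,a\in A\}$. -}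

module Defs where

open import Level using (Level; 0ℓ; Lift) renaming (suc to lsuc)
open import Data.Nat using (ℕ; zero; suc)
open import Data.Fin using (Fin; zero; suc; toℕ)
open import Data.List using (List; []; _∷_; _++_; [_]; length; lookup)
open import Data.List.Relation.Unary.Any using (Any)
open import Data.List.Membership.Propositional using (_∈_)
open import Data.Product using (Σ; _×_; _,_)
open import Data.Sum using (_⊎_; inj₁; inj₂)
open import Data.Empty using (⊥)
open import Relation.Nullary using (¬_)
open import Relation.Binary.PropositionalEquality using (_≡_)
open import Relation.Binary.Structures using (IsPartialOrder)

-- Monadic second-order logic over a relational signature with unary and
-- binary relation symbols (constants / the root are unary singletons).

record Signature : Set₁ where
  field
    UnSym  : Set
    BinSym : Set
open Signature public

data Formula (Sg : Signature) : ℕ → ℕ → Set where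
  _≐_   : ∀ {n m} → Fin n → Fin n → Formula Sg n m
  un    : ∀ {n m} → UnSym Sg → Fin n → Formula Sg n m
  bin   : ∀ {n m} → BinSym Sg → Fin n → Fin n → Formula Sg n m
  _∈ˢ_  : ∀ {n m} → Fin n → Fin m → Formula Sg n m
  ¬ᶠ_   : ∀ {n m} → Formula Sg n m → Formula Sg n m
  _∧ᶠ_  : ∀ {n m} → Formula Sg n m → Formula Sg n m → Formula Sg n m
  ∃¹    : ∀ {n m} → Formula Sg (suc n) m → Formula Sg n m
  ∃²    : ∀ {n m} → Formula Sg n (suc m) → Formula Sg n m

Sentence : Signature → Set
Sentence Sg = Formula Sg 0 0

record Structure (Sg : Signature) (ℓ : Level) : Set (lsuc ℓ) where
  field
    Carrier : Set
    _≈_     : Carrier → Carrier → Set ℓ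
    unRel   : UnSym Sg → Carrier → Set ℓ
    binRel  : BinSym Sg → Carrier → Carrier → Set ℓ
open Structure public

extend : ∀ {A : Set} {n} → A → (Fin n → A) → Fin (suc n) → A
extend a ν zero    = a
extend a ν (suc i) = ν i

-- Weak MSO satisfaction: set variables range over FINITE sets (given as lists).
Satʷ : ∀ {Sg ℓ n m} (𝔄 : Structure Sg ℓ) → Formula Sg n m →
       (Fin n → Carrier 𝔄) → (Fin m → List (Carrier 𝔄)) → Set ℓ
Satʷ 𝔄 (i ≐ j)     ν μ = _≈_ 𝔄 (ν i) (ν j)
Satʷ 𝔄 (un R i)    ν μ = unRel 𝔄 R (ν i)
Satʷ 𝔄 (bin R i j) ν μ = binRel 𝔄 R (ν i) (ν j)
Satʷ 𝔄 (i ∈ˢ X)    ν μ = Any (_≈_ 𝔄 (ν i)) (μ X)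
Satʷ 𝔄 (¬ᶠ φ)      ν μ = ¬ Satʷ 𝔄 φ ν μ
Satʷ 𝔄 (φ ∧ᶠ ψ)    ν μ = Satʷ 𝔄 φ ν μ × Satʷ 𝔄 ψ ν μ
Satʷ 𝔄 (∃¹ φ)      ν μ = Σ (Carrier 𝔄) λ a → Satʷ 𝔄 φ (extend a ν) μ
Satʷ 𝔄 (∃² φ)      ν μ = Σ (List (Carrier 𝔄)) λ X → Satʷ 𝔄 φ ν (extend X μ)

noVar : ∀ {A : Set} → Fin 0 → A
noVar ()

_⊨ʷ_ : ∀ {Sg ℓ} (𝔄 : Structure Sg ℓ) → Sentence Sg → Set ℓ
𝔄 ⊨ʷ φ = Satʷ 𝔄 φ noVar noVar

record Tree : Set₁ where
  field
    T              : Set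
    _≤_            : T → T → Set
    root           : T
    isPartialOrder : IsPartialOrder _≡_ _≤_
    root-least     : ∀ v → root ≤ v
    preds-finite   : ∀ v → Σ (List T) λ l → ∀ u → u ≤ v → u ∈ l
    preds-linear   : ∀ v u w → u ≤ v → w ≤ v → (u ≤ w) ⊎ (w ≤ u)
open Tree public

module _ (t : Tree) where
  private _≤t_ = _≤_ t

  IsChain : (T t → Set) → Set
  IsChain C = ∀ x y → C x → C y → (x ≤t y) ⊎ (y ≤t x)

  IsFiniteSet : (T t → Set) → Set
  IsFiniteSet C = Σ (List (T t)) λ l → ∀ x → C x → x ∈ l

  IsInfiniteBranch : (T t → Set) → Set₁
  IsInfiniteBranch C =
    IsChain C
    × (∀ (D : T t → Set) → IsChain D → (∀ x → C x → D x) → ∀ x → D x → C x)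
    × ¬ IsFiniteSet C

  InU : T t → Set₁
  InU v = Σ (T t → Set) λ C → IsInfiniteBranch C × C v

data TreeUnSym : Set where
  rootSym uSym : TreeUnSym

data TreeBinSym : Set where
  leqSym : TreeBinSym

TreeUSig : Signature
TreeUSig = record { UnSym = TreeUnSym ; BinSym = TreeBinSym }

TreeU : Tree → Structure TreeUSig (lsuc 0ℓ)
TreeU t = record
  { Carrier = T t
  ; _≈_     = λ x y → Lift (lsuc 0ℓ) (x ≡ y)
  ; unRel   = λ { rootSym v → Lift (lsuc 0ℓ) (v ≡ root t)
                ; uSym v    → InU t v }
  ; binRel  = λ { leqSym x y → Lift (lsuc 0ℓ) (_≤_ t x y) }
  }

-- Infinitary Muchnik iteration of (T, ≤, r):
-- (T^∞, ⪯, ≤̂, r̂, ε, clone), with T^∞ = finite words ⊎ infinite words.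

Word : Set → Set
Word A = List A ⊎ (ℕ → A)

_≈w_ : ∀ {A : Set} → Word A → Word A → Set
inj₁ u ≈w inj₁ v = u ≡ v
inj₁ u ≈w inj₂ g = ⊥
inj₂ f ≈w inj₁ v = ⊥
inj₂ f ≈w inj₂ g = ∀ i → f i ≡ g i

_⪯_ : ∀ {A : Set} → Word A → Word A → Set
inj₁ u ⪯ inj₁ v = Σ (List _) λ w → u ++ w ≡ v
inj₁ u ⪯ inj₂ g = ∀ (i : Fin (length u)) → lookup u i ≡ g (toℕ i)
inj₂ f ⪯ inj₁ v = ⊥
inj₂ f ⪯ inj₂ g = ∀ i → f i ≡ g i

data MuchnikUnSym : Set where
  rootHat epsSym cloneSym : MuchnikUnSym

data MuchnikBinSym : Set where
  prefixSym leqHat : MuchnikBinSym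

MuchnikSig : Signature
MuchnikSig = record { UnSym = MuchnikUnSym ; BinSym = MuchnikBinSym }

Muchnik : Tree → Structure MuchnikSig 0ℓ
Muchnik t = record
  { Carrier = Word (T t)
  ; _≈_     = _≈w_
  ; unRel   = λ
      { rootHat w  → Σ (List (T t)) λ u → w ≡ inj₁ (u ++ [ root t ])
      ; epsSym w   → w ≡ inj₁ []
      ; cloneSym w → Σ (List (T t)) λ u → Σ (T t) λ a → w ≡ inj₁ (u ++ a ∷ a ∷ [])
      }
  ; binRel  = λ
      { prefixSym w₁ w₂ → w₁ ⪯ w₂
      ; leqHat w₁ w₂ → Σ (List (T t)) λ u → Σ (T t) λ a → Σ (T t) λ b →
          (w₁ ≡ inj₁ (u ++ [ a ])) × (w₂ ≡ inj₁ (u ++ [ b ])) × _≤_ t a b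
      }
  }

module Submission where

-- The predicate U (union of the infinite branches of a tree) is weak-MSO
-- definable in the infinitary Muchnik iteration, on the copy of T formed by
-- the one-letter words.
--
-- Classically, v ∈ U iff v lies below the start of a strictly
--    ascending sequence g₀ < g₁ < ⋯ : such a sequence is never bounded (the
--    predecessors of a node are finitely many), so its downward closure is an
--    infinite branch; conversely an infinite chain has no maximum, and
--    iterating "pick a larger element" inside a branch through v gives one.
-- 2. Iteration.  An infinite word g all of whose steps g n < g (n+1) are strict
--    is the same thing as a strictly ascending sequence; "infinite", "finite of
--    length ≥ 2", "one letter" and "last step strict" (via clone words u a a)
--    are first-order definable, which gives a formula inUᶠ for U on letters.
-- 3. Translation.  red relativises first-order quantifiers to letters, keeps
--    set quantifiers and replaces U by inUᶠ; an induction on formulas relating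
--    tree elements to their letters and finite sets to lists of words shows
--    that red preserves weak satisfaction, which is the theorem.

open import Defs
open import Level using (0ℓ; Lift; lift) renaming (suc to lsuc)
open import Data.Nat as ℕ using (ℕ; zero; suc; _≤′_; ≤′-refl; ≤′-step; _⊔_)
import Data.Nat.Properties as ℕ
open import Data.Fin using (Fin; zero; suc; toℕ)
open import Data.Fin.Properties using (pigeonhole)
open import Data.List using (List; []; _∷_; _++_; [_]; length; lookup; map; applyUpTo)
open import Data.List.Properties
  using (∷-injectiveˡ; ∷-injectiveʳ; ∷ʳ-injective; ++-assoc; applyUpTo-∷ʳ; lookup-applyUpTo)
open import Data.List.Relation.Unary.Any as Any using (Any; here; there)
open import Data.List.Relation.Unary.Any.Properties using (lookup-index; map⁺; map⁻)
open import Data.List.Membership.Propositional using (_∈_)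
open import Data.Product using (Σ; _×_; _,_; proj₁; proj₂)
open import Data.Product.Function.NonDependent.Propositional using (_×-⇔_)
open import Data.Sum using (inj₁; inj₂; [_,_]′)
open import Data.Sum.Properties using (inj₁-injective)
open import Data.Empty using (⊥-elim)
open import Relation.Nullary using (¬_)
open import Relation.Binary.PropositionalEquality
  using (_≡_; refl; sym; trans; cong; cong₂; subst)
open import Relation.Binary.Structures using (IsPartialOrder)
open import Function using (_∘_; id)
open import Function.Bundles using (_⇔_; mk⇔; Equivalence)
open import Function.Construct.Composition using (_⇔-∘_)
open import Function.Related.TypeIsomorphisms using (¬-cong-⇔)
open import Axiom.ExcludedMiddle using (ExcludedMiddle)
open import Axiom.DoubleNegationElimination using (DoubleNegationElimination; em⇒dne)

open Equivalence using (to; from)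

⪯-infinite : ∀ {A : Set} {g : ℕ → A} (l : List A) → inj₁ l ⪯ inj₂ g →
             l ≡ applyUpTo g (length l)
⪯-infinite []      _    = refl
⪯-infinite {g = g} (a ∷ l) l⪯g =
  cong₂ _∷_ (l⪯g zero) (⪯-infinite {g = g ∘ suc} l (l⪯g ∘ suc))

applyUpTo-last-two : ∀ {A : Set} (g : ℕ → A) n →
                     applyUpTo g (suc (suc n)) ≡ (applyUpTo g n ++ [ g n ]) ++ [ g (suc n) ]
applyUpTo-last-two g n =
  trans (sym (applyUpTo-∷ʳ g (suc n))) (cong (_++ [ g (suc n) ]) (sym (applyUpTo-∷ʳ g n)))

-- Infinite branches as strictly ascending sequences, in a fixed tree t.

module Branches (t : Tree) where
  private
    _⊑_ = _≤_ t
    module ⊑ = IsPartialOrder (isPartialOrder t)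

  _⊏_ : T t → T t → Set
  x ⊏ y = (x ⊑ y) × ¬ (x ≡ y)

  Ascending : (ℕ → T t) → Set
  Ascending g = ∀ n → g n ⊏ g (suc n)

  AscentAbove : T t → Set
  AscentAbove v = Σ (ℕ → T t) λ g → Ascending g × (v ⊑ g zero)

  module _ {g : ℕ → T t} (asc : Ascending g) where

    ascending-mono : ∀ {m n} → m ℕ.≤ n → g m ⊑ g n
    ascending-mono m≤n = along (ℕ.≤⇒≤′ m≤n)
      where
      along : ∀ {m n} → m ≤′ n → g m ⊑ g n
      along ≤′-refl      = ⊑.refl
      along (≤′-step m≤n) = ⊑.trans (along m≤n) (proj₁ (asc _))

    ascending-injective : ∀ {m n} → m ℕ.< n → ¬ (g m ≡ g n)
    ascending-injective {m} m<n gm≡gn =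
      proj₂ (asc m) (⊑.antisym (proj₁ (asc m)) (subst (g (suc m) ⊑_) (sym gm≡gn) (ascending-mono m<n)))

    -- By the pigeonhole principle it leaves every finite list.
    ascending-escapes : (l : List (T t)) → ¬ (∀ n → g n ∈ l)
    ascending-escapes l g∈l =
      let i , j , i<j , same-index = pigeonhole (ℕ.n<1+n (length l)) (Any.index ∘ g∈l ∘ toℕ)
      in ascending-injective i<j
           (trans (lookup-index (g∈l (toℕ i)))
             (trans (cong (lookup l) same-index) (sym (lookup-index (g∈l (toℕ j))))))

    -- Hence it has no upper bound, as the predecessors of a node are finitely many.
    ascending-unbounded : ∀ x → ¬ (∀ n → g n ⊑ x)
    ascending-unbounded x g⊑x =
      let l , preds∈l = preds-finite t x in ascending-escapes l (λ n → preds∈l (g n) (g⊑x n))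

  ascent⇒InU : DoubleNegationElimination 0ℓ → ∀ v → AscentAbove v → InU t v
  ascent⇒InU dne v (g , asc , v⊑g₀) = Below , (chain , maximal , infinite) , (zero , v⊑g₀)
    where
    Below : T t → Set
    Below x = Σ ℕ λ n → x ⊑ g n

    chain : IsChain t Below
    chain x y (m , x⊑gm) (n , y⊑gn) =
      preds-linear t (g (m ⊔ n)) x y
        (⊑.trans x⊑gm (ascending-mono asc (ℕ.m≤m⊔n m n)))
        (⊑.trans y⊑gn (ascending-mono asc (ℕ.m≤n⊔m m n)))

    -- An element x comparable with every g n but below none of them would
    -- bound the sequence.
    maximal : ∀ D → IsChain t D → (∀ x → Below x → D x) → ∀ x → D x → Below x
    maximal D chainD Below⊆D x Dx = dne λ x-not-below → ascending-unbounded asc x λ n →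
      [ (λ x⊑gn → ⊥-elim (x-not-below (n , x⊑gn))) , id ]′
        (chainD x (g n) Dx (Below⊆D (g n) (n , ⊑.refl)))

    infinite : ¬ IsFiniteSet t Below
    infinite (l , Below⊆l) = ascending-escapes asc l (λ n → Below⊆l (g n) (n , ⊑.refl))

  infinite-chain-step : DoubleNegationElimination 0ℓ → ∀ {C} → IsChain t C → ¬ IsFiniteSet t C →
                        ∀ c → C c → Σ (T t) λ x → C x × c ⊏ x
  infinite-chain-step dne {C} chain infinite c Cc = dne λ no-larger →
    let l , preds∈l = preds-finite t c
        below-c : ∀ x → C x → x ⊑ c
        below-c x Cx = dne λ x⋢c → no-larger (x , Cx , c⊏x x Cx x⋢c)
    in infinite (l , λ x Cx → preds∈l x (below-c x Cx))
    where
    c⊏x : ∀ x → C x → ¬ (x ⊑ c) → c ⊏ x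
    c⊏x x Cx x⋢c = [ id , (λ x⊑c → ⊥-elim (x⋢c x⊑c)) ]′ (chain c x Cc Cx)
                 , λ c≡x → x⋢c (⊑.reflexive (sym c≡x))

  -- Dependent choice: iterating a strict-successor step inside C.
  ascending-from : ∀ {C : T t → Set} → (∀ c → C c → Σ (T t) λ x → C x × c ⊏ x) →
                   ∀ v → C v → Σ (ℕ → T t) λ g → Ascending g × g zero ≡ v
  ascending-from {C} step v Cv = proj₁ ∘ walk , (λ n → proj₂ (proj₂ (step′ (walk n)))) , refl
    where
    step′ : (c : Σ (T t) C) → Σ (T t) λ x → C x × proj₁ c ⊏ x
    step′ (c , Cc) = step c Cc
    walk : ℕ → Σ (T t) C
    walk zero    = v , Cv
    walk (suc n) = proj₁ (step′ (walk n)) , proj₁ (proj₂ (step′ (walk n)))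

  InU⇔ascent : DoubleNegationElimination 0ℓ → ∀ v → InU t v ⇔ AscentAbove v
  InU⇔ascent dne v = mk⇔ InU⇒ascent (ascent⇒InU dne v)
    where
    InU⇒ascent : InU t v → AscentAbove v
    InU⇒ascent (C , (chain , _ , infinite) , Cv) =
      let g , asc , g₀≡v = ascending-from (infinite-chain-step dne chain infinite) v Cv
      in g , asc , ⊑.reflexive (sym g₀≡v)

_⪯ᶠ_ : ∀ {n m} → Fin n → Fin n → Formula MuchnikSig n m
i ⪯ᶠ j = bin prefixSym i j

-- z is a nonempty finite word (≤̂ relates only such words).
nonEmptyᶠ : ∀ {n m} → Fin n → Formula MuchnikSig n m
nonEmptyᶠ z = bin leqHat z z

-- z has a nonempty proper prefix: it is a finite word of length at least two.
longᶠ : ∀ {n m} → Fin n → Formula MuchnikSig n m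
longᶠ z = ∃¹ (((zero ⪯ᶠ suc z) ∧ᶠ (¬ᶠ (suc z ⪯ᶠ zero))) ∧ᶠ nonEmptyᶠ zero)

letterᶠ : ∀ {n m} → Fin n → Formula MuchnikSig n m
letterᶠ z = nonEmptyᶠ z ∧ᶠ (¬ᶠ longᶠ z)

-- z is an infinite word: no nonempty finite word extends it.
infiniteᶠ : ∀ {n m} → Fin n → Formula MuchnikSig n m
infiniteᶠ z = ¬ᶠ ∃¹ ((suc z ⪯ᶠ zero) ∧ᶠ nonEmptyᶠ zero)

-- z = u a b with a < b: some clone word u a a lies ≤̂-below z and differs from it.
strictStepᶠ : ∀ {n m} → Fin n → Formula MuchnikSig n m
strictStepᶠ z = ∃¹ ((un cloneSym zero ∧ᶠ bin leqHat zero (suc z)) ∧ᶠ (¬ᶠ (zero ≐ suc z)))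

-- x lies ≤̂-below the first letter of an infinite word whose steps are all
-- strict; on letters this defines U.
inUᶠ : ∀ {n m} → Fin n → Formula MuchnikSig n m
inUᶠ {n} {m} x = ∃¹ ((infiniteᶠ zero ∧ᶠ allStepsStrict)
                   ∧ᶠ ∃¹ ((zero ⪯ᶠ suc zero) ∧ᶠ bin leqHat (suc (suc x)) zero))
  where
  allStepsStrict : Formula MuchnikSig (suc n) m
  allStepsStrict = ¬ᶠ ∃¹ ((((zero ⪯ᶠ suc zero) ∧ᶠ nonEmptyᶠ zero) ∧ᶠ longᶠ zero)
                          ∧ᶠ (¬ᶠ strictStepᶠ zero))

red : ∀ {n m} → Formula TreeUSig n m → Formula MuchnikSig n m
red (i ≐ j)          = i ≐ j
red (un rootSym i)   = un rootHat i
red (un uSym i)      = inUᶠ i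
red (bin leqSym i j) = bin leqHat i j
red (i ∈ˢ X)         = i ∈ˢ X
red (¬ᶠ φ)           = ¬ᶠ red φ
red (φ ∧ᶠ ψ)         = red φ ∧ᶠ red ψ
red (∃¹ φ)           = ∃¹ (letterᶠ zero ∧ᶠ red φ)
red (∃² φ)           = ∃² (red φ)

module Iteration (t : Tree) where
  open Branches t
  private
    _⊑_ = _≤_ t
    module ⊑ = IsPartialOrder (isPartialOrder t)
    M = Muchnik t
    W = Word (T t)

  letter : T t → W
  letter a = inj₁ [ a ]

  _≤̂_ : W → W → Set
  _≤̂_ = binRel M leqHat

  -- What the auxiliary formulas say; each is their weak satisfaction
  -- relation unfolded, so the two are interchangeable by definition.
  NonEmpty Long IsLetter Infinite StrictStep AllStepsStrict InUᴹ : W → Set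
  NonEmpty w       = w ≤̂ w
  Long z           = Σ W λ y → ((y ⪯ z) × ¬ (z ⪯ y)) × NonEmpty y
  IsLetter w       = NonEmpty w × ¬ Long w
  Infinite w       = ¬ Σ W λ c → (w ⪯ c) × NonEmpty c
  StrictStep q     = Σ W λ c → (unRel M cloneSym c × c ≤̂ q) × ¬ (c ≈w q)
  AllStepsStrict w = ¬ Σ W λ q → (((q ⪯ w) × NonEmpty q) × Long q) × ¬ StrictStep q
  InUᴹ x           = Σ W λ w → (Infinite w × AllStepsStrict w) × Σ W λ q₀ → (q₀ ⪯ w) × x ≤̂ q₀

  nonEmpty-snoc : ∀ u a → NonEmpty (inj₁ (u ++ [ a ]))
  nonEmpty-snoc u a = u , a , a , refl , refl , ⊑.refl

  letter-snoc : ∀ {a b : T t} u → [ a ] ≡ u ++ [ b ] → u ≡ [] × a ≡ b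
  letter-snoc u e = let []≡u , a≡b = ∷ʳ-injective [] u e in sym []≡u , a≡b

  long-word : ∀ x u c → Long (inj₁ (x ∷ u ++ [ c ]))
  long-word x u c =
    letter x , ((u ++ [ c ] , refl) , λ (w , e) → snoc-nonempty u w (∷-injectiveʳ e)) , nonEmpty-snoc [] x
    where
    snoc-nonempty : ∀ u w → ¬ ((u ++ [ c ]) ++ w ≡ [])
    snoc-nonempty []      w ()
    snoc-nonempty (_ ∷ _) w ()

  long-shape : ∀ l → Long (inj₁ l) → Σ (T t) λ a → Σ (T t) λ b → Σ (List (T t)) λ r → l ≡ a ∷ b ∷ r
  long-shape _ (_ , ((([] , refl) , l⋠y) , ([] , _ , _ , refl , _))) = ⊥-elim (l⋠y ([] , refl))
  long-shape _ (_ , (((b ∷ r , refl) , _) , ([] , a , _ , refl , _)))  = a , b , r , refl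
  long-shape _ (_ , (((r , refl) , _) , (a ∷ [] , c , _ , refl , _)))    = a , c , r , refl
  long-shape _ (_ , (((r , refl) , _) , (a ∷ b ∷ u , c , _ , refl , _))) = a , b , (u ++ [ c ]) ++ r , refl

  isLetter⇔ : ∀ w → IsLetter w ⇔ Σ (T t) λ a → w ≡ letter a
  isLetter⇔ w = mk⇔ (letter-of w) (λ (a , w≡a) → subst IsLetter (sym w≡a) (letter-isLetter a))
    where
    letter-of : ∀ w → IsLetter w → Σ (T t) λ a → w ≡ letter a
    letter-of _ (([]    , a , _ , refl , _) , _)        = a , refl
    letter-of _ ((x ∷ u , a , _ , refl , _) , not-long) = ⊥-elim (not-long (long-word x u a))
    letter-isLetter : ∀ a → IsLetter (letter a)
    letter-isLetter a = nonEmpty-snoc [] a , λ long → case-two-letters (long-shape [ a ] long)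
      where
      case-two-letters : ¬ (Σ (T t) λ a′ → Σ (T t) λ b → Σ (List (T t)) λ r → [ a ] ≡ a′ ∷ b ∷ r)
      case-two-letters (_ , _ , _ , ())

  -- infiniteᶠ holds of no finite word u: the nonempty word u (root t) extends it.
  finite-not-infinite : ∀ u → ¬ Infinite (inj₁ u)
  finite-not-infinite u infinite =
    infinite (inj₁ (u ++ [ root t ]) , ([ root t ] , refl) , nonEmpty-snoc u (root t))

  strictStep-last-two : ∀ u x b → StrictStep (inj₁ ((u ++ [ x ]) ++ [ b ])) → x ⊏ b
  strictStep-last-two u x b (_ , ((s , y , refl) , (s′ , a , b′ , clone≡s′a , uxb≡s′b′ , a⊑b′)) , clone≉)
    with ∷ʳ-injective (s ++ [ y ]) s′ (trans (++-assoc s [ y ] [ y ]) (inj₁-injective clone≡s′a))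
  ... | refl , refl with ∷ʳ-injective (u ++ [ x ]) (s ++ [ y ]) (inj₁-injective uxb≡s′b′)
  ... | ux≡sy , refl with ∷ʳ-injective u s ux≡sy
  ... | refl , refl = a⊑b′ , λ { refl → clone≉ (sym (++-assoc u [ x ] [ x ])) }

  strictStep-at : ∀ u x b → x ⊏ b → StrictStep (inj₁ ((u ++ [ x ]) ++ [ b ]))
  strictStep-at u x b (x⊑b , x≢b) =
    inj₁ (u ++ x ∷ x ∷ []) ,
    ((u , x , refl) , (u ++ [ x ] , x , b , cong inj₁ (sym (++-assoc u [ x ] [ x ])) , refl , x⊑b)) ,
    λ e → x≢b (proj₂ (∷ʳ-injective (u ++ [ x ]) (u ++ [ x ]) (trans (++-assoc u [ x ] [ x ]) e)))

  prefix : (ℕ → T t) → ℕ → W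
  prefix g n = inj₁ (applyUpTo g n)

  prefix-⪯ : ∀ g n → prefix g n ⪯ inj₂ g
  prefix-⪯ g n = lookup-applyUpTo g n

  prefix-nonEmpty : ∀ g n → NonEmpty (prefix g (suc n))
  prefix-nonEmpty g n = subst (NonEmpty ∘ inj₁) (applyUpTo-∷ʳ g n) (nonEmpty-snoc (applyUpTo g n) (g n))

  prefix-long : ∀ g n → Long (prefix g (suc (suc n)))
  prefix-long g n = subst (Long ∘ inj₁ ∘ (g zero ∷_)) (applyUpTo-∷ʳ (g ∘ suc) n)
                          (long-word (g zero) (applyUpTo (g ∘ suc) n) (g (suc n)))

  prefix-last-two : ∀ g n → prefix g (suc (suc n)) ≡ inj₁ ((applyUpTo g n ++ [ g n ]) ++ [ g (suc n) ])
  prefix-last-two g n = cong inj₁ (applyUpTo-last-two g n)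

  long-prefix : ∀ g l → inj₁ l ⪯ inj₂ g → Long (inj₁ l) → Σ ℕ λ n → inj₁ l ≡ prefix g (suc (suc n))
  long-prefix g l l⪯g long =
    let _ , _ , r , l≡abr = long-shape l long
    in length r , cong inj₁ (trans (⪯-infinite l l⪯g) (cong (applyUpTo g ∘ length) l≡abr))

  ascent⇒InUᴹ : ∀ v → AscentAbove v → InUᴹ (letter v)
  ascent⇒InUᴹ v (g , asc , v⊑g₀) =
    inj₂ g , (infinite , all-strict) , letter (g zero) , prefix-⪯ g 1 , ([] , v , g zero , refl , refl , v⊑g₀)
    where
    infinite : Infinite (inj₂ g)
    infinite (inj₁ _ , () , _)
    infinite (inj₂ _ , _ , (_ , _ , _ , () , _))
    all-strict : AllStepsStrict (inj₂ g)
    all-strict (inj₂ _ , ((_ , (_ , _ , _ , () , _)) , _) , _)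
    all-strict (inj₁ l , ((l⪯g , _) , long) , not-strict) =
      let n , l≡prefix = long-prefix g l l⪯g long
      in not-strict (subst StrictStep (sym (trans l≡prefix (prefix-last-two g n)))
                                      (strictStep-at (applyUpTo g n) (g n) (g (suc n)) (asc n)))

  -- Conversely a witness of inUᶠ is an infinite word g, and each step of g is
  -- strict since the check at its prefix of length n+2 cannot fail.
  InUᴹ⇒ascent : DoubleNegationElimination 0ℓ → ∀ v → InUᴹ (letter v) → AscentAbove v
  InUᴹ⇒ascent dne v (inj₁ u , (infinite , _) , _) = ⊥-elim (finite-not-infinite u infinite)
  InUᴹ⇒ascent dne v (inj₂ g , (_ , all-strict) , q₀ , q₀⪯g , v≤̂q₀) = g , asc , v⊑g₀ q₀ q₀⪯g v≤̂q₀
    where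
    asc : Ascending g
    asc n = strictStep-last-two (applyUpTo g n) (g n) (g (suc n))
              (subst StrictStep (prefix-last-two g n) (dne λ not-strict →
                all-strict (prefix g (suc (suc n)) ,
                            ((prefix-⪯ g (suc (suc n)) , prefix-nonEmpty g (suc n)) , prefix-long g n) ,
                            not-strict)))
    -- q₀ is the first letter of g, since only one-letter words lie ≤̂-above a letter.
    v⊑g₀ : ∀ q₀ → q₀ ⪯ inj₂ g → letter v ≤̂ q₀ → v ⊑ g zero
    v⊑g₀ _ q₀⪯g (s , a , b , v≡sa , refl , a⊑b) with refl , refl ← letter-snoc s (inj₁-injective v≡sa) =
      subst (v ⊑_) (q₀⪯g zero) a⊑b

  InU⇔InUᴹ : DoubleNegationElimination 0ℓ → ∀ v → InU t v ⇔ InUᴹ (letter v)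
  InU⇔InUᴹ dne v = mk⇔ (ascent⇒InUᴹ v) (InUᴹ⇒ascent dne v) ⇔-∘ InU⇔ascent dne v

module Translation (t : Tree) where
  open Iteration t
  private
    _⊑_ = _≤_ t
    M = Muchnik t
    W = Word (T t)

  _∈ᵀ_ : T t → List (T t) → Set₁
  v ∈ᵀ L = Any (λ y → Lift (lsuc 0ℓ) (v ≡ y)) L

  _∈ᴹ_ : T t → List W → Set
  v ∈ᴹ L = Any (letter v ≈w_) L

  ∈ᵀ⇔∈ᴹ-map : ∀ L v → v ∈ᵀ L ⇔ v ∈ᴹ map letter L
  ∈ᵀ⇔∈ᴹ-map L v = mk⇔ (map⁺ ∘ Any.map (λ (lift v≡y) → cong [_] v≡y))
                       (Any.map (lift ∘ ∷-injectiveˡ) ∘ map⁻)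

  letters : List W → List (T t)
  letters []                     = []
  letters (inj₁ (a ∷ []) ∷ L)    = a ∷ letters L
  letters (inj₁ [] ∷ L)          = letters L
  letters (inj₁ (_ ∷ _ ∷ _) ∷ L) = letters L
  letters (inj₂ _ ∷ L)           = letters L

  ∈ᵀ⇔∈ᴹ-letters : ∀ L v → v ∈ᵀ letters L ⇔ v ∈ᴹ L
  ∈ᵀ⇔∈ᴹ-letters L v = mk⇔ (to′ L) (from′ L)
    where
    to′ : ∀ L → v ∈ᵀ letters L → v ∈ᴹ L
    to′ (inj₁ (a ∷ []) ∷ L)    (here (lift refl)) = here refl
    to′ (inj₁ (a ∷ []) ∷ L)    (there v∈L)        = there (to′ L v∈L)
    to′ (inj₁ [] ∷ L)          v∈L                = there (to′ L v∈L)
    to′ (inj₁ (_ ∷ _ ∷ _) ∷ L) v∈L                = there (to′ L v∈L)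
    to′ (inj₂ _ ∷ L)           v∈L                = there (to′ L v∈L)
    from′ : ∀ L → v ∈ᴹ L → v ∈ᵀ letters L
    from′ (inj₁ (a ∷ []) ∷ L)    (here refl) = here (lift refl)
    from′ (inj₁ (a ∷ []) ∷ L)    (there v∈L) = there (from′ L v∈L)
    from′ (inj₁ [] ∷ L)          (there v∈L) = from′ L v∈L
    from′ (inj₁ (_ ∷ _ ∷ _) ∷ L) (there v∈L) = from′ L v∈L
    from′ (inj₂ _ ∷ L)           (there v∈L) = from′ L v∈L

  Represents : ∀ {n} → (Fin n → T t) → (Fin n → W) → Set
  Represents ν ν′ = ∀ i → ν′ i ≡ letter (ν i)

  RepresentsSets : ∀ {m} → (Fin m → List (T t)) → (Fin m → List W) → Set₁
  RepresentsSets μ μ′ = ∀ X v → v ∈ᵀ μ X ⇔ v ∈ᴹ μ′ X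

  represents-extend : ∀ {n} {ν : Fin n → T t} {ν′ a w} →
                      w ≡ letter a → Represents ν ν′ → Represents (extend a ν) (extend w ν′)
  represents-extend w≡a rep zero    = w≡a
  represents-extend w≡a rep (suc i) = rep i

  representsSets-extend : ∀ {m} {μ : Fin m → List (T t)} {μ′ L L′} →
                          (∀ v → v ∈ᵀ L ⇔ v ∈ᴹ L′) → RepresentsSets μ μ′ →
                          RepresentsSets (extend L μ) (extend L′ μ′)
  representsSets-extend L≈L′ reps zero    = L≈L′
  representsSets-extend L≈L′ reps (suc X) = reps X

  letter-≡ : ∀ a b → Lift (lsuc 0ℓ) (a ≡ b) ⇔ (letter a ≈w letter b)
  letter-≡ a b = mk⇔ (λ (lift a≡b) → cong [_] a≡b) (lift ∘ ∷-injectiveˡ)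

  letter-root : ∀ a → Lift (lsuc 0ℓ) (a ≡ root t) ⇔ unRel M rootHat (letter a)
  letter-root a = mk⇔ (λ (lift a≡r) → [] , cong letter a≡r)
                      (λ (u , e) → lift (proj₂ (letter-snoc u (inj₁-injective e))))

  letter-≤̂ : ∀ a b → Lift (lsuc 0ℓ) (a ⊑ b) ⇔ (letter a ≤̂ letter b)
  letter-≤̂ a b = mk⇔ (λ (lift a⊑b) → [] , a , b , refl , refl , a⊑b) (lift ∘ from-letters)
    where
    from-letters : letter a ≤̂ letter b → a ⊑ b
    from-letters (u , _ , _ , a≡ua′ , b≡ub′ , a′⊑b′)
      with refl , refl ← letter-snoc u (inj₁-injective a≡ua′)
      with _ , refl ← letter-snoc [] (inj₁-injective b≡ub′) = a′⊑b′

  red-correct : DoubleNegationElimination 0ℓ → ∀ {n m} (φ : Formula TreeUSig n m) ν ν′ μ μ′ →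
                Represents ν ν′ → RepresentsSets μ μ′ →
                Satʷ (TreeU t) φ ν μ ⇔ Satʷ M (red φ) ν′ μ′
  red-correct dne (i ≐ j)          ν ν′ μ μ′ rep reps rewrite rep i | rep j = letter-≡ (ν i) (ν j)
  red-correct dne (un rootSym i)   ν ν′ μ μ′ rep reps rewrite rep i = letter-root (ν i)
  red-correct dne (un uSym i)      ν ν′ μ μ′ rep reps rewrite rep i = InU⇔InUᴹ dne (ν i)
  red-correct dne (bin leqSym i j) ν ν′ μ μ′ rep reps rewrite rep i | rep j = letter-≤̂ (ν i) (ν j)
  red-correct dne (i ∈ˢ X)         ν ν′ μ μ′ rep reps rewrite rep i = reps X (ν i)
  red-correct dne (¬ᶠ φ)   ν ν′ μ μ′ rep reps = ¬-cong-⇔ (red-correct dne φ ν ν′ μ μ′ rep reps)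
  red-correct dne (φ ∧ᶠ ψ) ν ν′ μ μ′ rep reps =
    red-correct dne φ ν ν′ μ μ′ rep reps ×-⇔ red-correct dne ψ ν ν′ μ μ′ rep reps
  -- A witness a corresponds to the witness letter a; a witness satisfying
  -- letterᶠ is letter a for some a.
  red-correct dne (∃¹ φ)   ν ν′ μ μ′ rep reps = mk⇔
    (λ (a , sat) → letter a , from (isLetter⇔ (letter a)) (a , refl) , to (IH a refl) sat)
    (λ (w , isLetter , sat) → let a , w≡a = to (isLetter⇔ w) isLetter in a , from (IH a w≡a) sat)
    where
    IH : ∀ a {w} → w ≡ letter a → Satʷ (TreeU t) φ (extend a ν) μ ⇔ Satʷ M (red φ) (extend w ν′) μ′
    IH a w≡a = red-correct dne φ (extend a ν) (extend _ ν′) μ μ′ (represents-extend w≡a rep) reps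
  -- A finite set L corresponds to its list of letters, a list of words to the letters it contains.
  red-correct dne (∃² φ)   ν ν′ μ μ′ rep reps = mk⇔
    (λ (L , sat) → map letter L , to (IH (∈ᵀ⇔∈ᴹ-map L)) sat)
    (λ (L′ , sat) → letters L′ , from (IH (∈ᵀ⇔∈ᴹ-letters L′)) sat)
    where
    IH : ∀ {L L′} → (∀ v → v ∈ᵀ L ⇔ v ∈ᴹ L′) →
         Satʷ (TreeU t) φ ν (extend L μ) ⇔ Satʷ M (red φ) ν′ (extend L′ μ′)
    IH L≈L′ = red-correct dne φ ν ν′ (extend _ μ) (extend _ μ′) rep (representsSets-extend L≈L′ reps)

-- Lemma 5.4.  red is a total structurally recursive function on formulas,
-- hence computable; under excluded middle it preserves weak satisfaction,
-- starting from the empty assignments, which trivially represent each other.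
lemma5p4 : Σ (Sentence TreeUSig → Sentence MuchnikSig) λ red →
             ExcludedMiddle 0ℓ → ExcludedMiddle (lsuc 0ℓ) →
             (t : Tree) (φ : Sentence TreeUSig) →
             (TreeU t ⊨ʷ φ) ⇔ (Muchnik t ⊨ʷ red φ)
lemma5p4 = red , λ em _ t φ →
  Translation.red-correct t (em⇒dne em) φ noVar noVar noVar noVar (λ ()) (λ ())
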